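{- Let $I=\langle\mathcal A,v\rangle$ be a plain interpretation (for $\mathbf{P}$). For every set $\Gamma$ of infons there exists a closed set $M$ of $\mathcal A$ with $v(\Gamma)\subseteq M$ such that for every infon $\varphi$, if $\Gamma\not\vdash\varphi$ in $\mathbf{P}$ then $v(\varphi)\notin M$.
   Context: Infons: fix a set $At$ of atomic infons; infons are generated by $\varphi ::= \top \mid At \mid (\varphi\wedge\varphi)\mid(\varphi\to\varphi)$. Derivability in $\mathbf{P}$: $\Gamma\vdash\varphi$ iff there is a finite sequence $\varphi_1,\dots,\varphi_n=\varphi$ where each $\varphi_k$ is in $\Gamma\cup\{\top\}$ or follows from earlier members by one of the rules: from $\varphi_1,\varphi_2$ infer $\varphi_1\wedge\varphi_2$; from $\varphi_1\wedge\varphi_2$ infer $\varphi_i$ ($i=1,2$); from $\varphi_2$ infer $\varphi_1\to\varphi_2$; from $\varphi_1$ and $\varphi_1\to\varphi_2$ infer $\varphi_2$. A set $T$ of infons is deductively closed if $T\vdash\psi$ implies $\psi\in T$. Infon algebra: $\Sigma=\{0,1\}$; $\mathcal A=\langle\Sigma^*,\pi,l,r,\mathrm{enc},\mathrm{dec},E\rangle$ where $\pi,\mathrm{enc}:(\Sigma^*)^2\to\Sigma^*$ are total, $l,r,\mathrm{dec}$ are partial, with $l(\pi(x,y))=x$, $r(\pi(x,y))=y$, $\mathrm{dec}(x,\mathrm{enc}(x,y))=y$ defined and valid for all $x,y$, and $\emptyset\neq E\subseteq\Sigma^*$. A set $M\subseteq\Sigma^*$ is closed if $E\subseteq M$ and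 for all $a,b\in\Sigma^*$: (1) $a,b\in M\iff\pi(a,b)\in M$; (2) $a\in M$ and $\mathrm{enc}(a,b)\in M$ imply $b\in M$; (3) $b\in M$ implies $\mathrm{enc}(a,b)\in M$. An interpretation is $I=\langle\mathcal A,v\rangle$ with $v:At\cup\{\top\}\to\Sigma^*$ total, $v(\top)\in E$, extended by $v(\varphi_1\wedge\varphi_2)=\pi(v(\varphi_1),v(\varphi_2))$, $v(\varphi_1\to\varphi_2)=\mathrm{enc}(v(\varphi_1),v(\varphi_2))$, $v(\Gamma)=\{v(\psi):\psi\in\Gamma\}$. It is plain if it is injective ($v(\varphi_1)=v(\varphi_2)$ implies $\varphi_1=\varphi_2$ for infons) and conservative (for every deductively closed set $T$ of infons, the least closed set containing $v(T)$ contains no string $v(\psi)$ with $\psi\notin T$). -}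

module Defs where

open import Level using (0ℓ)
open import Data.Bool using (Bool)
open import Data.List using (List)
open import Data.Maybe using (Maybe; just)
open import Data.Product using (Σ; ∃; _×_; _,_)
open import Relation.Binary.PropositionalEquality using (_≡_)
open import Relation.Nullary using (¬_)
open import Relation.Unary using (Pred; _∈_; _∉_; _⊆_)

Str : Set
Str = List Bool

data Infon (At : Set) : Set where
  ⊤'  : Infon At
  atom : At → Infon At
  _∧'_ : Infon At → Infon At → Infon At
  _⇒'_ : Infon At → Infon At → Infon At

-- Derivability in P (inductive rendering of finite derivation sequences)
data _⊢_ {At : Set} (Γ : Pred (Infon At) 0ℓ) : Infon At → Set where
  hyp   : ∀ {φ} → φ ∈ Γ → Γ ⊢ φ
  top   : Γ ⊢ ⊤'
  ∧-i   : ∀ {φ ψ} → Γ ⊢ φ → Γ ⊢ ψ → Γ ⊢ (φ ∧' ψ)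
  ∧-e₁  : ∀ {φ ψ} → Γ ⊢ (φ ∧' ψ) → Γ ⊢ φ
  ∧-e₂  : ∀ {φ ψ} → Γ ⊢ (φ ∧' ψ) → Γ ⊢ ψ
  ⇒-i   : ∀ {φ ψ} → Γ ⊢ ψ → Γ ⊢ (φ ⇒' ψ)
  ⇒-e   : ∀ {φ ψ} → Γ ⊢ φ → Γ ⊢ (φ ⇒' ψ) → Γ ⊢ ψ

DeductivelyClosed : {At : Set} → Pred (Infon At) 0ℓ → Set
DeductivelyClosed T = ∀ ψ → T ⊢ ψ → ψ ∈ T

record InfonAlgebra : Set₁ where
  field
    π   : Str → Str → Str
    l   : Str → Maybe Str
    r   : Str → Maybe Str
    enc : Str → Str → Str
    dec : Str → Str → Maybe Str
    E   : Pred Str 0ℓ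
    l-π   : ∀ x y → l (π x y) ≡ just x
    r-π   : ∀ x y → r (π x y) ≡ just y
    dec-enc : ∀ x y → dec x (enc x y) ≡ just y
    E-nonempty : ∃ λ e → e ∈ E

module _ (𝒜 : InfonAlgebra) where
  open InfonAlgebra 𝒜

  record Closed (M : Pred Str 0ℓ) : Set where
    field
      E⊆M    : E ⊆ M
      π-intro : ∀ a b → a ∈ M → b ∈ M → π a b ∈ M
      π-elimˡ : ∀ a b → π a b ∈ M → a ∈ M
      π-elimʳ : ∀ a b → π a b ∈ M → b ∈ M
      enc-elim  : ∀ a b → a ∈ M → enc a b ∈ M → b ∈ M
      enc-intro : ∀ a b → b ∈ M → enc a b ∈ M

  data LeastClosed (S : Pred Str 0ℓ) : Pred Str 0ℓ where
    base   : ∀ {s} → s ∈ S → LeastClosed S s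
    inE    : ∀ {s} → s ∈ E → LeastClosed S s
    π-i    : ∀ {a b} → LeastClosed S a → LeastClosed S b → LeastClosed S (π a b)
    π-eˡ   : ∀ {a b} → LeastClosed S (π a b) → LeastClosed S a
    π-eʳ   : ∀ {a b} → LeastClosed S (π a b) → LeastClosed S b
    enc-e  : ∀ {a b} → LeastClosed S a → LeastClosed S (enc a b) → LeastClosed S b
    enc-i  : ∀ {a b} → LeastClosed S b → LeastClosed S (enc a b)

record Interpretation (At : Set) : Set₁ where
  field
    𝒜    : InfonAlgebra
    vAt  : At → Str
    v⊤   : Str
    v⊤∈E : v⊤ ∈ InfonAlgebra.E 𝒜

  open InfonAlgebra 𝒜

  v : Infon At → Str
  v ⊤'       = v⊤
  v (atom a) = vAt a
  v (φ ∧' ψ) = π (v φ) (v ψ)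
  v (φ ⇒' ψ) = enc (v φ) (v ψ)

  vImg : Pred (Infon At) 0ℓ → Pred Str 0ℓ
  vImg Γ s = Σ (Infon At) λ ψ → ψ ∈ Γ × v ψ ≡ s

  Injective : Set
  Injective = ∀ φ ψ → v φ ≡ v ψ → φ ≡ ψ

  Conservative : Set₁
  Conservative = ∀ (T : Pred (Infon At) 0ℓ) → DeductivelyClosed T →
    ∀ ψ → ψ ∉ T → v ψ ∉ LeastClosed 𝒜 (vImg T)

  Plain : Set₁
  Plain = Injective × Conservative

module Submission where

open import Defs
open import Level using (0ℓ)
open import Data.Product using (Σ; _×_; _,_)
open import Relation.Nullary using (¬_)
open import Relation.Unary using (Pred; _∉_; _⊆_)

-- Take M to be the least closed set containing v of the deductive closure of Γ.
-- That closure is deductively closed, so conservativity of I says exactly that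
-- M contains v φ only for consequences φ of Γ.

Consequences : {At : Set} → Pred (Infon At) 0ℓ → Pred (Infon At) 0ℓ
Consequences Γ φ = Γ ⊢ φ

⊢-cut : {At : Set} {Γ : Pred (Infon At) 0ℓ} {φ : Infon At} →
        Consequences Γ ⊢ φ → Γ ⊢ φ
⊢-cut (hyp d)   = d
⊢-cut top       = top
⊢-cut (∧-i d e) = ∧-i (⊢-cut d) (⊢-cut e)
⊢-cut (∧-e₁ d)  = ∧-e₁ (⊢-cut d)
⊢-cut (∧-e₂ d)  = ∧-e₂ (⊢-cut d)
⊢-cut (⇒-i d)   = ⇒-i (⊢-cut d)
⊢-cut (⇒-e d e) = ⇒-e (⊢-cut d) (⊢-cut e)

Consequences-deductivelyClosed : {At : Set} (Γ : Pred (Infon At) 0ℓ) →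
                                 DeductivelyClosed (Consequences Γ)
Consequences-deductivelyClosed Γ _ = ⊢-cut

LeastClosed-closed : (𝒜 : InfonAlgebra) (S : Pred Str 0ℓ) → Closed 𝒜 (LeastClosed 𝒜 S)
LeastClosed-closed 𝒜 S = record
  { E⊆M       = inE
  ; π-intro   = λ _ _ → π-i
  ; π-elimˡ   = λ _ _ → π-eˡ
  ; π-elimʳ   = λ _ _ → π-eʳ
  ; enc-elim  = λ _ _ → enc-e
  ; enc-intro = λ _ _ → enc-i
  }

vImg-⊆-LeastClosed-Consequences : {At : Set} (I : Interpretation At) (Γ : Pred (Infon At) 0ℓ) →
    Interpretation.vImg I Γ ⊆
      LeastClosed (Interpretation.𝒜 I) (Interpretation.vImg I (Consequences Γ))
vImg-⊆-LeastClosed-Consequences I Γ (ψ , ψ∈Γ , vψ≡s) = base (ψ , hyp ψ∈Γ , vψ≡s)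

theorem2 : {At : Set} (I : Interpretation At) → Interpretation.Plain I →
    (Γ : Pred (Infon At) 0ℓ) →
    Σ (Pred Str 0ℓ) λ M → Closed (Interpretation.𝒜 I) M
      × (Interpretation.vImg I Γ ⊆ M)
      × (∀ φ → ¬ (Γ ⊢ φ) → Interpretation.v I φ ∉ M)
theorem2 I (_ , conservative) Γ =
    LeastClosed 𝒜 (vImg (Consequences Γ))
  , LeastClosed-closed 𝒜 (vImg (Consequences Γ))
  , vImg-⊆-LeastClosed-Consequences I Γ
  , conservative (Consequences Γ) (Consequences-deductivelyClosed Γ)
  where open Interpretation I
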